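{- Let $z$ be a variable (or a positive rational number), and let $u$ and $v$ be positive integers. For all nonnegative integers $n$ and all $i = 1,2,\ldots,2^n$, \[ c^{(u,v)}_z(n,i)\, c^{(v,u)}_{z^{ -1}}(n,2^n+1-i) = 1. \] If $u = v \geq 1$, then for all nonnegative integers $n$ and $i = 1,2,\ldots,2^n$, \[ c^{(u,u)}(n,i)\, c^{(u,u)}(n,2^n+1-i) = 1. \]
   Context: For positive integers $u,v$, let $L_u = \begin{pmatrix} 1 & 0 \\ u & 1\end{pmatrix}$ and $R_v = \begin{pmatrix} 1 & v \\ 0 & 1\end{pmatrix}$, acting as linear fractional transformations $L_u(w) = \frac{w}{uw+1}$ and $R_v(w) = w+v$. For a root $z$, the rooted infinite binary tree $\mathcal{T}^{(u,v)}_z$ is built inductively: row $0$ consists of $z$, and each vertex $w$ has left child $L_u(w)$ and right child $R_v(w)$. Denote by $c^{(u,v)}_z(n,i)$ the $i$th number (from left to right) on row $n$ of this tree, for $n \geq 0$ and $i = 1,\ldots,2^n$; thus $c^{(u,v)}_z(0,1) = z$, $c^{(u,v)}_z(n+1,2i-1) = L_u(c^{(u,v)}_z(n,i))$ and $c^{(u,v)}_z(n+1,2i) = R_v(c^{(u,v)}_z(n,i))$. In the second statement, $c^{(u,u)}(n,i)$ denotes the entries of the tree with root $z = 1$ (i.e. $c^{(u,u)}_1(n,i)$). -}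

module Defs where

open import Data.Nat as ℕ using (ℕ; zero; suc)
open import Data.Nat.DivMod using (_%_)
open import Data.Integer using (+_)
open import Data.Rational as ℚ using (ℚ; Positive; NonNegative; 1/_; _÷_; _*_; _+_; 1ℚ)
open import Data.Rational.Properties
  using (pos⇒nonZero; pos⇒nonNeg; nonNeg+pos⇒pos; nonNeg*nonNeg⇒nonNeg; pos*pos⇒pos; 1/pos⇒pos; pos+nonNeg⇒pos)
import Data.Nat.Coprimality as Cop
open import Data.Product using (Σ; _,_; proj₁)

ℚ⁺ : Set
ℚ⁺ = Σ ℚ Positive

ℕ→ℚ : ℕ → ℚ
ℕ→ℚ u = ℚ.mkℚ (+ u) 0 (Cop.sym (Cop.1-coprimeTo u))

nonNeg-ℕ→ℚ : (u : ℕ) → NonNegative (ℕ→ℚ u)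
nonNeg-ℕ→ℚ u = _

private
  pos-uw+1 : (u : ℕ) (w : ℚ) → Positive w → Positive (ℕ→ℚ u * w + 1ℚ)
  pos-uw+1 u w pw =
    nonNeg+pos⇒pos (ℕ→ℚ u * w)
      {{nonNeg*nonNeg⇒nonNeg (ℕ→ℚ u) {{nonNeg-ℕ→ℚ u}} w {{pos⇒nonNeg w {{pw}}}}}}
      1ℚ

Lmap : ℕ → ℚ⁺ → ℚ⁺
Lmap u (w , pw) =
  ( (w ÷ d) {{pos⇒nonZero d {{pd}}}}
  , pos*pos⇒pos w {{pw}} _ {{1/pos⇒pos d {{pd}}}} )
  where
  d = ℕ→ℚ u * w + 1ℚ
  pd = pos-uw+1 u w pw

Rmap : ℕ → ℚ⁺ → ℚ⁺
Rmap v (w , pw) = (w + ℕ→ℚ v , pos+nonNeg⇒pos w {{pw}} (ℕ→ℚ v) {{nonNeg-ℕ→ℚ v}})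

-- c^{(u,v)}_z(n,i) for 1 ≤ i ≤ 2^n (values for out-of-range i are irrelevant):
--   c(0,1) = z,  c(n+1,2i-1) = L_u(c(n,i)),  c(n+1,2i) = R_v(c(n,i)).
-- For i odd, i = 2j-1 with j = (i+1)/2; for i even, i = 2j with j = i/2.
cTree : (u v : ℕ) → ℚ⁺ → ℕ → ℕ → ℚ⁺
cTree u v z zero    i = z
cTree u v z (suc n) i with i % 2
... | zero = Rmap v (cTree u v z n (i ℕ./ 2))
... | suc _ = Lmap u (cTree u v z n (suc i ℕ./ 2))

c : (u v : ℕ) → ℚ⁺ → ℕ → ℕ → ℚ
c u v z n i = proj₁ (cTree u v z n i)

inv⁺ : ℚ⁺ → ℚ⁺
inv⁺ (z , pz) = ((1/ z) {{pos⇒nonZero z {{pz}}}} , 1/pos⇒pos z {{pz}})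

one⁺ : ℚ⁺
one⁺ = (1ℚ , _)

-- Inversion w ↦ 1/w conjugates L_u into R_u, since 1/(w/(uw+1)) = 1/w + u. Hence
-- x·y = 1 implies L_u(x)·R_u(y) = 1 and R_v(x)·L_v(y) = 1. The reflection
-- i ↦ 2^n + 1 − i of a row sends left children to right children, so by induction on n
-- the i-th entry of the (u,v)-tree rooted at z and the reflected entry of the
-- (v,u)-tree rooted at 1/z stay reciprocal. The second claim is the case u = v, z = 1.
module Submission where

open import Defs
open import Data.Nat using (ℕ; _≤_; _^_; _+_; _∸_; zero; suc; z≤n; s≤s; _%_; _/_)
import Data.Nat as ℕ
import Data.Nat.Properties as ℕₚ
open import Data.Nat.DivMod using (m*n%n≡0; m*n/n≡m; [m+kn]%n≡m%n)
open import Data.Rational using (ℚ; _*_; 1ℚ; _÷_; 1/_; NonZero)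
import Data.Rational as ℚ
import Data.Rational.Properties as ℚₚ
open import Data.Product using (_×_; _,_; proj₁)
open import Function using (_∘_)
open import Relation.Binary.PropositionalEquality

Reciprocal : ℚ⁺ → ℚ⁺ → Set
Reciprocal x y = proj₁ x * proj₁ y ≡ 1ℚ

reciprocal-sym : ∀ x y → Reciprocal x y → Reciprocal y x
reciprocal-sym x y xy = trans (ℚₚ.*-comm (proj₁ y) (proj₁ x)) xy

÷-reciprocal-+ : ∀ (t a b : ℚ) → a * b ≡ 1ℚ → .{{_ : NonZero (t * a ℚ.+ 1ℚ)}} →
                 (a ÷ (t * a ℚ.+ 1ℚ)) * (b ℚ.+ t) ≡ 1ℚ
÷-reciprocal-+ t a b ab = begin
  (a * 1/ d) * (b ℚ.+ t)  ≡⟨ ℚₚ.*-assoc a (1/ d) (b ℚ.+ t) ⟩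
  a * (1/ d * (b ℚ.+ t))  ≡⟨ cong (a *_) (ℚₚ.*-comm (1/ d) (b ℚ.+ t)) ⟩
  a * ((b ℚ.+ t) * 1/ d)  ≡⟨ ℚₚ.*-assoc a (b ℚ.+ t) (1/ d) ⟨
  (a * (b ℚ.+ t)) * 1/ d  ≡⟨ cong (_* 1/ d) numerator≡d ⟩
  d * 1/ d                ≡⟨ ℚₚ.*-inverseʳ d ⟩
  1ℚ                      ∎
  where
  open ≡-Reasoning
  d : ℚ
  d = t * a ℚ.+ 1ℚ
  numerator≡d : a * (b ℚ.+ t) ≡ d
  numerator≡d = begin
    a * (b ℚ.+ t)    ≡⟨ ℚₚ.*-distribˡ-+ a b t ⟩
    a * b ℚ.+ a * t  ≡⟨ cong₂ ℚ._+_ ab (ℚₚ.*-comm a t) ⟩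
    1ℚ ℚ.+ t * a     ≡⟨ ℚₚ.+-comm 1ℚ (t * a) ⟩
    d                ∎

Lmap-Rmap-reciprocal : ∀ u x y → Reciprocal x y → Reciprocal (Lmap u x) (Rmap u y)
Lmap-Rmap-reciprocal u (a , pa) (b , _) ab =
  ÷-reciprocal-+ (ℕ→ℚ u) a b ab {{ℚₚ.pos⇒nonZero (ℕ→ℚ u * a ℚ.+ 1ℚ) {{d>0}}}}
  where
  d>0 : ℚ.Positive (ℕ→ℚ u * a ℚ.+ 1ℚ)
  d>0 = ℚₚ.nonNeg+pos⇒pos (ℕ→ℚ u * a)
          {{ℚₚ.nonNeg*nonNeg⇒nonNeg (ℕ→ℚ u) {{nonNeg-ℕ→ℚ u}} a {{ℚₚ.pos⇒nonNeg a {{pa}}}}}} 1ℚ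

Rmap-Lmap-reciprocal : ∀ u x y → Reciprocal x y → Reciprocal (Rmap u x) (Lmap u y)
Rmap-Lmap-reciprocal u x y xy =
  reciprocal-sym (Lmap u y) (Rmap u x) (Lmap-Rmap-reciprocal u y x (reciprocal-sym x y xy))

inv⁺-reciprocal : ∀ z → Reciprocal z (inv⁺ z)
inv⁺-reciprocal (z , pz) = ℚₚ.*-inverseʳ z {{ℚₚ.pos⇒nonZero z {{pz}}}}

data ParityView : ℕ → Set where
  even : ∀ k → ParityView (2 ℕ.* k)
  odd  : ∀ k → ParityView (suc (2 ℕ.* k))

parityView : ∀ n → ParityView n
parityView zero = even 0
parityView (suc n) with parityView n
... | even k = odd k
... | odd k  = subst ParityView (ℕₚ.*-suc 2 k) (even (suc k))

2*n%2≡0 : ∀ n → 2 ℕ.* n % 2 ≡ 0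
2*n%2≡0 n = trans (cong (_% 2) (ℕₚ.*-comm 2 n)) (m*n%n≡0 n 2)

2*n/2≡n : ∀ n → 2 ℕ.* n / 2 ≡ n
2*n/2≡n n = trans (cong (_/ 2) (ℕₚ.*-comm 2 n)) (m*n/n≡m n 2)

1+2*n%2≡1 : ∀ n → suc (2 ℕ.* n) % 2 ≡ 1
1+2*n%2≡1 n = trans (cong (λ m → suc m % 2) (ℕₚ.*-comm 2 n)) ([m+kn]%n≡m%n 1 n 2)

2+2*n/2≡1+n : ∀ n → suc (suc (2 ℕ.* n)) / 2 ≡ suc n
2+2*n/2≡1+n n = trans (cong (λ m → suc (suc m) / 2) (ℕₚ.*-comm 2 n)) (m*n/n≡m (suc n) 2)

cTree-even : ∀ u v z n k → cTree u v z (suc n) (2 ℕ.* k) ≡ Rmap v (cTree u v z n k)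
cTree-even u v z n k rewrite 2*n%2≡0 k = cong (Rmap v ∘ cTree u v z n) (2*n/2≡n k)

cTree-odd : ∀ u v z n k → cTree u v z (suc n) (suc (2 ℕ.* k)) ≡ Lmap u (cTree u v z n (suc k))
cTree-odd u v z n k rewrite 1+2*n%2≡1 k = cong (Lmap u ∘ cTree u v z n) (2+2*n/2≡1+n k)

mirror : ℕ → ℕ → ℕ
mirror m i = m + 1 ∸ i

mirror≡suc∸ : ∀ m i → mirror m i ≡ suc m ∸ i
mirror≡suc∸ m i = cong (_∸ i) (ℕₚ.+-comm m 1)

mirror-≤ : ∀ {m j} → j ≤ m → mirror m j ≡ suc (m ∸ j)
mirror-≤ {m} {j} j≤m = trans (mirror≡suc∸ m j) (ℕₚ.+-∸-assoc 1 j≤m)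

mirror-even : ∀ {m j} → j ≤ m → mirror (2 ℕ.* m) (2 ℕ.* j) ≡ suc (2 ℕ.* (m ∸ j))
mirror-even {m} {j} j≤m =
  trans (mirror-≤ (ℕₚ.*-monoʳ-≤ 2 j≤m)) (cong suc (sym (ℕₚ.*-distribˡ-∸ 2 m j)))

mirror-odd : ∀ m k → mirror (2 ℕ.* m) (suc (2 ℕ.* k)) ≡ 2 ℕ.* mirror m (suc k)
mirror-odd m k = begin
  mirror (2 ℕ.* m) (suc (2 ℕ.* k))  ≡⟨ mirror≡suc∸ (2 ℕ.* m) (suc (2 ℕ.* k)) ⟩
  2 ℕ.* m ∸ 2 ℕ.* k                 ≡⟨ ℕₚ.*-distribˡ-∸ 2 m k ⟨
  2 ℕ.* (m ∸ k)                     ≡⟨ cong (2 ℕ.*_) (mirror≡suc∸ m (suc k)) ⟨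
  2 ℕ.* mirror m (suc k)            ∎
  where open ≡-Reasoning

1≤2*n⇒1≤n : ∀ {n} → 1 ≤ 2 ℕ.* n → 1 ≤ n
1≤2*n⇒1≤n {suc n} _ = s≤s z≤n

cTree-reciprocal : ∀ u v z w → Reciprocal z w → ∀ n i → 1 ≤ i → i ≤ 2 ^ n →
                   Reciprocal (cTree u v z n i) (cTree v u w n (mirror (2 ^ n) i))
cTree-reciprocal u v z w zw zero i _ _ = zw
cTree-reciprocal u v z w zw (suc n) i 1≤i i≤2m with parityView i
... | even j =
  subst₂ Reciprocal (sym (cTree-even u v z n j)) (sym mirror-child)
    (Rmap-Lmap-reciprocal v (cTree u v z n j) (cTree v u w n (mirror m j))
      (cTree-reciprocal u v z w zw n j (1≤2*n⇒1≤n 1≤i) j≤m))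
  where
  open ≡-Reasoning
  m : ℕ
  m = 2 ^ n
  j≤m : j ≤ m
  j≤m = ℕₚ.*-cancelˡ-≤ 2 i≤2m
  mirror-child : cTree v u w (suc n) (mirror (2 ℕ.* m) (2 ℕ.* j)) ≡ Lmap v (cTree v u w n (mirror m j))
  mirror-child = begin
    cTree v u w (suc n) (mirror (2 ℕ.* m) (2 ℕ.* j))  ≡⟨ cong (cTree v u w (suc n)) (mirror-even j≤m) ⟩
    cTree v u w (suc n) (suc (2 ℕ.* (m ∸ j)))         ≡⟨ cTree-odd v u w n (m ∸ j) ⟩
    Lmap v (cTree v u w n (suc (m ∸ j)))              ≡⟨ cong (Lmap v ∘ cTree v u w n) (mirror-≤ j≤m) ⟨
    Lmap v (cTree v u w n (mirror m j))               ∎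
... | odd k =
  subst₂ Reciprocal (sym (cTree-odd u v z n k)) (sym mirror-child)
    (Lmap-Rmap-reciprocal u (cTree u v z n (suc k)) (cTree v u w n (mirror m (suc k)))
      (cTree-reciprocal u v z w zw n (suc k) (s≤s z≤n) k<m))
  where
  m : ℕ
  m = 2 ^ n
  k<m : suc k ≤ m
  k<m = ℕₚ.*-cancelˡ-< 2 k m i≤2m
  mirror-child : cTree v u w (suc n) (mirror (2 ℕ.* m) (suc (2 ℕ.* k))) ≡ Rmap u (cTree v u w n (mirror m (suc k)))
  mirror-child = trans (cong (cTree v u w (suc n)) (mirror-odd m k)) (cTree-even v u w n (mirror m (suc k)))

theorem2 : ((u v : ℕ) → 1 ≤ u → 1 ≤ v → (z : ℚ⁺) → (n i : ℕ) → 1 ≤ i → i ≤ 2 ^ n →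
    c u v z n i * c v u (inv⁺ z) n (2 ^ n + 1 ∸ i) ≡ 1ℚ)
    ×
    ((u : ℕ) → 1 ≤ u → (n i : ℕ) → 1 ≤ i → i ≤ 2 ^ n →
    c u u one⁺ n i * c u u one⁺ n (2 ^ n + 1 ∸ i) ≡ 1ℚ)
theorem2 = (λ u v _ _ z → cTree-reciprocal u v z (inv⁺ z) (inv⁺-reciprocal z))
         , (λ u _ → cTree-reciprocal u u one⁺ one⁺ refl)
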